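{- Let $k\ge4$, $n=2k-1$, $\lambda\in\overline{\mathcal{U}}_{T_n}$, and let $Y_{S_\lambda}$ be its Keith--Nath Young diagram with hook lengths $h_{i,j}$. Let $z\ge1$ be the integer such that $h_{1,z+1}=n-2$. Then $$\sum_{i=2}^{z} h_{i,z+1}=k.$$
   Context: Partitions into distinct parts: $\lambda=(\lambda_1<\dots<\lambda_t)$, $t\ge2$. Missing parts $\mathcal{M}_\lambda=\{1,\dots,\lambda_t\}\setminus\{\lambda_i\}$. Unrefinable: no two distinct missing parts sum to a part. Maximal: largest part is maximum among unrefinable partitions of the same integer. $\overline{\mathcal{U}}_N$: maximal unrefinable partitions of $N$ with $\#\mathcal{M}_\lambda=\lfloor\lambda_t/2\rfloor$. $T_n=n(n+1)/2$. $S_\lambda=\mathbb{N}_0\setminus\lambda$; $Y_{S_\lambda}$ (English convention) has one row per part $g$ of $\lambda$, ordered top to bottom by decreasing $g$, the row of $g$ having $\#\{s\in S_\lambda:s<g\}$ cells. $h_{i,j}$ is the hook length (arm + leg + 1) of the cell in row $i$, column $j$. -}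

module Defs where

open import Data.Nat using (ℕ; zero; suc; _+_; _*_; _∸_; _≤_; _<_; _⊔_; _≤?_)
open import Data.Nat.Properties using (_≟_)
open import Data.Nat.DivMod using (_/_)
open import Data.Nat.ListAction using (sum)
open import Data.List using (List; []; _∷_; length; map; filter; upTo; foldr; reverse)
open import Data.List.Relation.Unary.All using (All)
open import Data.List.Relation.Unary.Linked using (Linked)
open import Data.List.Membership.Propositional using (_∈_; _∉_)
open import Data.List.Membership.DecPropositional _≟_ using (_∈?_)
open import Data.Product using (_×_)
open import Relation.Nullary using (¬_; ¬?)
open import Relation.Binary.PropositionalEquality using (_≡_; _≢_)

IsDistinctPartition : List ℕ → Set
IsDistinctPartition ps = Linked _<_ ps × All (1 ≤_) ps × 2 ≤ length ps

largest : List ℕ → ℕ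
largest ps = foldr _⊔_ 0 ps

IsMissing : List ℕ → ℕ → Set
IsMissing ps m = 1 ≤ m × m ≤ largest ps × m ∉ ps

missingParts : List ℕ → List ℕ
missingParts ps = filter (λ m → ¬? (m ∈? ps)) (map suc (upTo (largest ps)))

numMissing : List ℕ → ℕ
numMissing ps = length (missingParts ps)

Unrefinable : List ℕ → Set
Unrefinable ps = ∀ a b → a ≢ b → IsMissing ps a → IsMissing ps b → (a + b) ∉ ps

MaximalUnrefinable : ℕ → List ℕ → Set
MaximalUnrefinable N ps =
  IsDistinctPartition ps × sum ps ≡ N × Unrefinable ps ×
  (∀ qs → IsDistinctPartition qs → sum qs ≡ N → Unrefinable qs → largest qs ≤ largest ps)

InUbar : ℕ → List ℕ → Set
InUbar N ps = MaximalUnrefinable N ps × numMissing ps ≡ largest ps / 2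

T : ℕ → ℕ
T n = (n * suc n) / 2

nth : List ℕ → ℕ → ℕ
nth []       _       = 0
nth (x ∷ xs) zero    = x
nth (x ∷ xs) (suc i) = nth xs i

-- the part labelling row i (1-based, top row = largest part); 0 if i out of range
rowPart : List ℕ → ℕ → ℕ
rowPart ps i = nth (reverse ps) (i ∸ 1)

-- row length of row i in Y_{S_λ}: #{ s ∈ S_λ : s < g }, S_λ = ℕ₀ ∖ λ
-- (0 for rows i outside 1..t)
rowLen : List ℕ → ℕ → ℕ
rowLen ps i = length (filter (λ s → ¬? (s ∈? ps)) (upTo (rowPart ps i)))

leg : List ℕ → ℕ → ℕ → ℕ
leg ps i j = length (filter (λ i' → j ≤? rowLen ps i')
                           (map (λ d → i + suc d) (upTo (length ps ∸ i))))

-- arm of cell (i,j) (columns 1-based)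
arm : List ℕ → ℕ → ℕ → ℕ
arm ps i j = rowLen ps i ∸ j

hook : List ℕ → ℕ → ℕ → ℕ
hook ps i j = arm ps i j + leg ps i j + 1

hookColSum : List ℕ → ℕ → ℕ → ℕ
hookColSum ps z c = sum (map (λ d → hook ps (2 + d) c) (upTo (z ∸ 1)))

{-# OPTIONS --safe #-}
-- Let L be the largest part of λ and c = ⌈L/2⌉.  By unrefinability each pair {a, L − a} with
-- a < L/2 contains at most one element of S_λ (for a = 0 because L is a part).  As S_λ has
-- #M + 1 = ⌊L/2⌋ + 1 elements up to L, each pair contains exactly one, and so does {L/2} for
-- even L.  Hence λ has c parts and 2 |λ| + c = c² + 2E, where E sums L − 2a over the pairs
-- whose part is the upper member L − a.
-- By maximality, the unrefinable partition {1, …, n − 3, n + 1, 2n − 4} of T n gives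
-- L ≥ 2n − 4, and with |λ| = T n the identity leaves only L = 2n − 4 (for odd L the other
-- summands of E would be distinct odd numbers adding up to 2).  So c = n − 2 and
-- Σ_{g ∈ λ} (g ∸ c) = E / 2 = 3k − 3.
-- In Y_{S_λ} the column indexed by the gap c has hook length g − c in the row of each part
-- g > c.  Hook lengths strictly decrease along a row and the first row has L − c = n − 2 in
-- that column, so it is column z + 1; as λ has c parts, z is also the number of parts above c,
-- and the requested sum is (3k − 3) − (L − c) = k.

module Submission where

open import Defs

open import Data.Bool using (if_then_else_)
open import Data.Empty using (⊥; ⊥-elim)
open import Data.List using (List; []; _∷_; length; map; filter; applyUpTo; reverse)
open import Data.List.Membership.Propositional using (_∈_; _∉_)
open import Data.List.Membership.Propositional.Properties using (foldr-selective)
open import Data.List.Properties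
  using (foldr-preservesᵒ; length-filter; length-reverse; map-applyUpTo; map-id; map-upTo; reverse-map; unfold-reverse)
open import Data.List.Relation.Binary.Permutation.Propositional.Properties using (↭-reverse)
open import Data.List.Relation.Unary.All as All using (All; []; _∷_)
open import Data.List.Relation.Unary.All.Properties using (All¬⇒¬Any)
open import Data.List.Relation.Unary.AllPairs as AllPairs using (AllPairs; []; _∷_)
import Data.List.Relation.Unary.AllPairs.Properties as AllPairsP
open import Data.List.Relation.Unary.Any as Any using (here; there)
import Data.List.Relation.Unary.Any.Properties as AnyP
open import Data.List.Relation.Unary.Linked using (Linked; [-]; _∷_)
open import Data.List.Relation.Unary.Linked.Properties using (Linked⇒AllPairs)
open import Data.List.Relation.Unary.Unique.Propositional using (Unique)
open import Data.Nat using (ℕ; zero; suc; _+_; _*_; _∸_; _≤_; _<_; _>_; _≤?_; _<?_; z≤n; s≤s; s≤s⁻¹; z<s)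
open import Data.Nat.DivMod using (_/_; _%_; m*n/n≡m; m%n<n; m≡m%n+[m/n]*n)
open import Data.Nat.ListAction using (sum)
open import Data.Nat.ListAction.Properties using (sum-↭)
open import Data.Nat.Properties
open import Data.List.Membership.DecPropositional _≟_ using (_∈?_)
open import Data.Nat.Tactic.RingSolver using (solve-∀)
open import Data.Product using (_×_; _,_; proj₁; proj₂)
open import Data.Sum as Sum using (_⊎_; inj₁; inj₂; [_,_]′)
open import Function using (_∘_; id)
open import Relation.Binary.Definitions using (tri<; tri≈; tri>)
open import Relation.Binary.PropositionalEquality
open import Relation.Nullary using (Dec; yes; no; does; ¬_; ¬?)
open import Relation.Unary using (Decidable)

m<n∸o⇒o+m<n : ∀ {m n o} → o ≤ n → m < n ∸ o → o + m < n
m<n∸o⇒o+m<n {m} {n} {o} o≤n m<n∸o =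
  subst (_≤ n) (cong suc (+-comm m o)) (m≤o∸n⇒m+n≤o (suc m) o≤n m<n∸o)

o+m<n⇒m<n∸o : ∀ {m n o} → o + m < n → m < n ∸ o
o+m<n⇒m<n∸o {m} {n} {o} o+m<n = m+n≤o⇒m≤o∸n (suc m) (subst (_≤ n) (cong suc (+-comm o m)) o+m<n)

k+k≤1+h+h⇒k≤h : ∀ {k h} → k + k ≤ suc (h + h) → k ≤ h
k+k≤1+h+h⇒k≤h {k} {h} k+k≤ =
  ≮⇒≥ (λ h<k → 1+n≰n (≤-trans (subst (_≤ k + k) (+-suc (suc h) h) (+-mono-≤ h<k h<k)) k+k≤))

≢⇒k+k<a+b : ∀ {k a b} → k ≤ a → k ≤ b → a ≢ b → k + k < a + b
≢⇒k+k<a+b {k} {a} {b} k≤a k≤b a≢b with <-cmp a b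
... | tri< a<b _ _ = subst (_≤ a + b) (+-suc k k) (+-mono-≤ k≤a (≤-<-trans k≤a a<b))
... | tri≈ _ a≡b _ = ⊥-elim (a≢b a≡b)
... | tri> _ _ b<a = +-mono-≤ (≤-<-trans k≤b b<a) k≤b

one-of-pair : ∀ {x y} a e → x + y ≡ 1 → x * a + y * (a + e) ≡ a + y * e
one-of-pair {x} {y} a e x+y≡1 = begin
  x * a + y * (a + e)   ≡⟨ distribute x y a e ⟩
  (x + y) * a + y * e   ≡⟨ cong (λ s → s * a + y * e) x+y≡1 ⟩
  1 * a + y * e         ≡⟨ cong (_+ y * e) (*-identityˡ a) ⟩
  a + y * e             ∎
  where
  open ≡-Reasoning
  distribute : ∀ x y a e → x * a + y * (a + e) ≡ (x + y) * a + y * e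
  distribute = solve-∀

half-parity : ∀ n → n ≡ n / 2 + n / 2 ⊎ n ≡ suc (n / 2 + n / 2)
half-parity n = Sum.map n≡r+h+h n≡r+h+h (n≤1⇒n≡0∨n≡1 (s≤s⁻¹ (m%n<n n 2)))
  where
  double : ∀ x → x * 2 ≡ x + x
  double = solve-∀
  n≡r+h+h : ∀ {r} → n % 2 ≡ r → n ≡ r + (n / 2 + n / 2)
  n≡r+h+h n%2≡r = trans (m≡m%n+[m/n]*n n 2) (cong₂ _+_ n%2≡r (double (n / 2)))

-- Finite sums over initial segments of ℕ

∑ : ℕ → (ℕ → ℕ) → ℕ
∑ zero    f = 0
∑ (suc n) f = ∑ n f + f n

infixr 6.5 ∑
syntax ∑ n (λ a → e) = ∑[ a < n ] e

∑-cong : ∀ {f g} n → (∀ a → a < n → f a ≡ g a) → ∑ n f ≡ ∑ n g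
∑-cong zero    f≡g = refl
∑-cong (suc n) f≡g = cong₂ _+_ (∑-cong n (λ a a<n → f≡g a (m<n⇒m<1+n a<n))) (f≡g n ≤-refl)

∑-distrib-+ : ∀ f g n → ∑[ a < n ] (f a + g a) ≡ ∑ n f + ∑ n g
∑-distrib-+ f g zero    = refl
∑-distrib-+ f g (suc n) = begin
  ∑[ a < n ] (f a + g a) + (f n + g n) ≡⟨ cong (_+ (f n + g n)) (∑-distrib-+ f g n) ⟩
  ∑ n f + ∑ n g + (f n + g n)          ≡⟨ +-+-swap (∑ n f) (∑ n g) (f n) (g n) ⟩
  ∑ n f + f n + (∑ n g + g n)          ∎
  where
  open ≡-Reasoning
  +-+-swap : ∀ a b c d → a + b + (c + d) ≡ a + c + (b + d)
  +-+-swap = solve-∀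

*-distribˡ-∑ : ∀ c f n → c * ∑ n f ≡ ∑[ a < n ] c * f a
*-distribˡ-∑ c f zero    = *-zeroʳ c
*-distribˡ-∑ c f (suc n) = trans (*-distribˡ-+ c (∑ n f) (f n)) (cong (_+ c * f n) (*-distribˡ-∑ c f n))

∑-const : ∀ c n → ∑[ _ < n ] c ≡ n * c
∑-const c zero    = refl
∑-const c (suc n) = trans (cong (_+ c) (∑-const c n)) (+-comm (n * c) c)

∑-zero : ∀ {f} n → (∀ a → a < n → f a ≡ 0) → ∑ n f ≡ 0
∑-zero n f≡0 = trans (∑-cong n f≡0) (trans (∑-const 0 n) (*-zeroʳ n))

∑-unfoldˡ : ∀ f n → ∑ (suc n) f ≡ f 0 + ∑[ a < n ] f (suc a)
∑-unfoldˡ f zero    = +-comm 0 (f 0)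
∑-unfoldˡ f (suc n) = begin
  ∑ (suc n) f + f (suc n)                 ≡⟨ cong (_+ f (suc n)) (∑-unfoldˡ f n) ⟩
  f 0 + ∑[ a < n ] f (suc a) + f (suc n)  ≡⟨ +-assoc (f 0) _ _ ⟩
  f 0 + ∑[ a < suc n ] f (suc a)          ∎
  where open ≡-Reasoning

∑-split : ∀ f m n → ∑ (m + n) f ≡ ∑ m f + ∑[ a < n ] f (m + a)
∑-split f m zero    = trans (cong (λ k → ∑ k f) (+-identityʳ m)) (sym (+-identityʳ _))
∑-split f m (suc n) = begin
  ∑ (m + suc n) f                                ≡⟨ cong (λ k → ∑ k f) (+-suc m n) ⟩
  ∑ (m + n) f + f (m + n)                        ≡⟨ cong (_+ f (m + n)) (∑-split f m n) ⟩
  ∑ m f + ∑[ a < n ] f (m + a) + f (m + n)       ≡⟨ +-assoc (∑ m f) _ _ ⟩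
  ∑ m f + ∑[ a < suc n ] f (m + a)               ∎
  where open ≡-Reasoning

∑-mono-≤ : ∀ {f g} n → (∀ a → a < n → f a ≤ g a) → ∑ n f ≤ ∑ n g
∑-mono-≤ zero    f≤g = z≤n
∑-mono-≤ (suc n) f≤g = +-mono-≤ (∑-mono-≤ n (λ a a<n → f≤g a (m<n⇒m<1+n a<n))) (f≤g n ≤-refl)

∑-monoˡ-≤ : ∀ f {m n} → m ≤ n → ∑ m f ≤ ∑ n f
∑-monoˡ-≤ f {m} {n} m≤n = begin
  ∑ m f                                 ≤⟨ m≤m+n (∑ m f) _ ⟩
  ∑ m f + ∑[ a < n ∸ m ] f (m + a)      ≡⟨ ∑-split f m (n ∸ m) ⟨
  ∑ (m + (n ∸ m)) f                     ≡⟨ cong (λ k → ∑ k f) (m+[n∸m]≡n m≤n) ⟩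
  ∑ n f                                 ∎
  where open ≤-Reasoning

∑-≤1⇒≤n : ∀ {f} n → (∀ a → a < n → f a ≤ 1) → ∑ n f ≤ n
∑-≤1⇒≤n n f≤1 = ≤-trans (∑-mono-≤ n f≤1) (≤-reflexive (trans (∑-const 1 n) (*-identityʳ n)))

∑-≤1-saturated : ∀ {f} n → (∀ a → a < n → f a ≤ 1) → n ≤ ∑ n f → ∀ a → a < n → f a ≡ 1
∑-≤1-saturated {f} (suc n) f≤1 1+n≤∑ a a<1+n with m≤n⇒m<n∨m≡n (s≤s⁻¹ a<1+n)
... | inj₁ a<n = ∑-≤1-saturated n (λ b b<n → f≤1 b (m<n⇒m<1+n b<n)) n≤∑ a a<n
  where
  n≤∑ : n ≤ ∑ n f
  n≤∑ = +-cancelʳ-≤ 1 n (∑ n f) (≤-trans (≤-reflexive (+-comm n 1))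
                                   (≤-trans 1+n≤∑ (+-monoʳ-≤ (∑ n f) (f≤1 n ≤-refl))))
... | inj₂ refl = ≤-antisym (f≤1 a ≤-refl) 1≤fa
  where
  1≤fa : 1 ≤ f a
  1≤fa = +-cancelˡ-≤ a 1 (f a) (≤-trans (≤-reflexive (+-comm a 1))
           (≤-trans 1+n≤∑ (+-monoˡ-≤ (f a) (∑-≤1⇒≤n a (λ b b<a → f≤1 b (m<n⇒m<1+n b<a))))))

∑-fold : ∀ f m r → ∑ (m + r + m) f ≡ ∑[ a < r ] f (m + a) + ∑[ d < m ] (f (m ∸ suc d) + f (m + r + d))
∑-fold f zero    r = trans (cong (λ k → ∑ k f) (+-identityʳ r)) (sym (+-identityʳ _))
∑-fold f (suc m) r = begin
  ∑ (suc m + r + suc m) f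
    ≡⟨ cong (λ k → ∑ (suc k) f) (+-suc (m + r) m) ⟩
  ∑ (suc (m + r + m)) f + f (suc (m + r + m))
    ≡⟨ cong (_+ f (suc (m + r + m))) (∑-unfoldˡ f (m + r + m)) ⟩
  f 0 + ∑ (m + r + m) f′ + f (suc (m + r + m))
    ≡⟨ cong (λ x → f 0 + x + f (suc (m + r + m))) (∑-fold f′ m r) ⟩
  f 0 + (M + P) + f (suc (m + r + m))
    ≡⟨ regroup (f 0) M P (f (suc (m + r + m))) ⟩
  M + (P + (f 0 + f (suc (m + r + m))))
    ≡⟨ cong₂ (λ x y → M + (x + (f y + f (suc (m + r + m)))))
             (∑-cong m (λ d d<m → cong (λ x → f x + f (suc (m + r + d))) (sym (+-∸-assoc 1 d<m))))
             (sym (n∸n≡0 m)) ⟩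
  M + ∑[ d < suc m ] (f (suc m ∸ suc d) + f (suc m + r + d))
    ∎
  where
  open ≡-Reasoning
  f′ = λ a → f (suc a)
  M = ∑[ a < r ] f′ (m + a)
  P = ∑[ d < m ] (f′ (m ∸ suc d) + f′ (m + r + d))
  regroup : ∀ a b c d → a + (b + c) + d ≡ b + (c + (a + d))
  regroup = solve-∀

2*∑[c∸1+d]+c≡c*c : ∀ c → 2 * (∑[ d < c ] (c ∸ suc d)) + c ≡ c * c
2*∑[c∸1+d]+c≡c*c zero    = refl
2*∑[c∸1+d]+c≡c*c (suc c) = begin
  2 * (∑[ d < suc c ] (suc c ∸ suc d)) + suc c
    ≡⟨ cong (λ s → 2 * s + suc c) (∑-unfoldˡ (λ d → suc c ∸ suc d) c) ⟩
  2 * (c + ∑[ d < c ] (c ∸ suc d)) + suc c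
    ≡⟨ regroup c (∑[ d < c ] (c ∸ suc d)) ⟩
  (2 * (∑[ d < c ] (c ∸ suc d)) + c) + (2 * c + 1)
    ≡⟨ cong (_+ (2 * c + 1)) (2*∑[c∸1+d]+c≡c*c c) ⟩
  c * c + (2 * c + 1)
    ≡⟨ square c ⟩
  suc c * suc c
    ∎
  where
  open ≡-Reasoning
  regroup : ∀ c s → 2 * (c + s) + suc c ≡ (2 * s + c) + (2 * c + 1)
  regroup = solve-∀
  square : ∀ c → c * c + (2 * c + 1) ≡ suc c * suc c
  square = solve-∀

∑-odd≢2 : ∀ {b : ℕ → ℕ} n → (∀ d → b d ≤ 1) → ∑[ d < n ] b d * suc (d + d) ≢ 2
∑-odd≢2     zero    _   ()
∑-odd≢2 {b} (suc n) b≤1 eq with n≤1⇒n≡0∨n≡1 (b≤1 n)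
... | inj₁ bn≡0 =
  ∑-odd≢2 n b≤1 (trans (sym (+-identityʳ S)) (subst (λ x → S + x * suc (n + n) ≡ 2) bn≡0 eq))
  where
  S = ∑[ d < n ] b d * suc (d + d)
... | inj₂ bn≡1 = top-term-≢2 n (subst (λ x → ∑[ d < n ] b d * suc (d + d) + x * suc (n + n) ≡ 2) bn≡1 eq)
  where
  top-term-≢2 : ∀ n → ∑[ d < n ] b d * suc (d + d) + 1 * suc (n + n) ≢ 2
  top-term-≢2 zero    ()
  top-term-≢2 (suc m) eq = <-irrefl refl (≤-trans 3≤top (≤-trans (m≤n+m _ _) (≤-reflexive eq)))
    where
    3+2m≡top : ∀ m → 3 + 2 * m ≡ 1 * suc (suc m + suc m)
    3+2m≡top = solve-∀
    3≤top : 3 ≤ 1 * suc (suc m + suc m)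
    3≤top = subst (3 ≤_) (3+2m≡top m) (m≤m+n 3 (2 * m))

-- Indicators and counting

𝟙 : ∀ {p} {P : Set p} → Dec P → ℕ
𝟙 d = if does d then 1 else 0

module _ {p} {P : Set p} where

  𝟙-yes : (d : Dec P) → P → 𝟙 d ≡ 1
  𝟙-yes (yes _)  _ = refl
  𝟙-yes (no ¬p)  p = ⊥-elim (¬p p)

  𝟙-no : (d : Dec P) → ¬ P → 𝟙 d ≡ 0
  𝟙-no (yes p) ¬p = ⊥-elim (¬p p)
  𝟙-no (no _)  _  = refl

  𝟙≤1 : (d : Dec P) → 𝟙 d ≤ 1
  𝟙≤1 (yes _) = ≤-refl
  𝟙≤1 (no _)  = z≤n

  𝟙>0⇒ : (d : Dec P) → 0 < 𝟙 d → P
  𝟙>0⇒ (yes p) _ = p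

  𝟙-¬+𝟙 : (d : Dec P) → 𝟙 (¬? d) + 𝟙 d ≡ 1
  𝟙-¬+𝟙 (yes _) = refl
  𝟙-¬+𝟙 (no _)  = refl

𝟙-mono : ∀ {p q} {P : Set p} {Q : Set q} (dp : Dec P) (dq : Dec Q) → (P → Q) → 𝟙 dp ≤ 𝟙 dq
𝟙-mono (yes p) dq P→Q = ≤-reflexive (sym (𝟙-yes dq (P→Q p)))
𝟙-mono (no _)  _  _   = z≤n

𝟙-cong : ∀ {p q} {P : Set p} {Q : Set q} (dp : Dec P) (dq : Dec Q) → (P → Q) → (Q → P) → 𝟙 dp ≡ 𝟙 dq
𝟙-cong dp dq P→Q Q→P = ≤-antisym (𝟙-mono dp dq P→Q) (𝟙-mono dq dp Q→P)

∑-𝟙<? : ∀ {k} n → k ≤ n → ∑[ d < n ] 𝟙 (d <? k) ≡ k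
∑-𝟙<? {k} n k≤n = begin
  ∑[ d < n ] 𝟙 (d <? k)                                  ≡⟨ cong (λ m → ∑[ d < m ] 𝟙 (d <? k)) (m+[n∸m]≡n k≤n) ⟨
  ∑[ d < k + (n ∸ k) ] 𝟙 (d <? k)                        ≡⟨ ∑-split _ k (n ∸ k) ⟩
  ∑[ d < k ] 𝟙 (d <? k) + ∑[ a < n ∸ k ] 𝟙 (k + a <? k)  ≡⟨ cong₂ _+_ below above ⟩
  k + 0                                                  ≡⟨ +-identityʳ k ⟩
  k                                                      ∎
  where
  open ≡-Reasoning
  below : ∑[ d < k ] 𝟙 (d <? k) ≡ k
  below = trans (∑-cong k (λ d d<k → 𝟙-yes (d <? k) d<k)) (trans (∑-const 1 k) (*-identityʳ k))
  above : ∑[ a < n ∸ k ] 𝟙 (k + a <? k) ≡ 0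
  above = ∑-zero (n ∸ k) (λ a _ → 𝟙-no (k + a <? k) (m+n≮m k a))

sum-applyUpTo : ∀ f n → sum (applyUpTo f n) ≡ ∑ n f
sum-applyUpTo f zero    = refl
sum-applyUpTo f (suc n) = trans (cong (f 0 +_) (sum-applyUpTo (f ∘ suc) n)) (sym (∑-unfoldˡ f n))

sum-map-nth : ∀ f xs → sum (map f xs) ≡ ∑[ j < length xs ] f (nth xs j)
sum-map-nth f []       = refl
sum-map-nth f (x ∷ xs) =
  trans (cong (f x +_) (sum-map-nth f xs)) (sym (∑-unfoldˡ (λ j → f (nth (x ∷ xs) j)) (length xs)))

nth∈ : ∀ xs {j} → j < length xs → nth xs j ∈ xs
nth∈ (x ∷ xs) {zero}  _         = here refl
nth∈ (x ∷ xs) {suc j} (s≤s j<n) = there (nth∈ xs j<n)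

∈⇒≤largest : ∀ {x} xs → x ∈ xs → x ≤ largest xs
∈⇒≤largest xs x∈xs =
  foldr-preservesᵒ (λ a b → [ m≤n⇒m≤n⊔o b , m≤n⇒m≤o⊔n a ]′) 0 xs (inj₂ (Any.map ≤-reflexive x∈xs))

𝟙-∈-∷ : ∀ a {x} {xs : List ℕ} → x ∉ xs → 𝟙 (a ∈? x ∷ xs) ≡ 𝟙 (a ≟ x) + 𝟙 (a ∈? xs)
𝟙-∈-∷ a {x} {xs} x∉xs = split (a ≟ x)
  where
  split : (d : Dec (a ≡ x)) → 𝟙 (a ∈? x ∷ xs) ≡ 𝟙 d + 𝟙 (a ∈? xs)
  split (yes refl) = trans (𝟙-yes (a ∈? a ∷ xs) (here refl)) (cong suc (sym (𝟙-no (a ∈? xs) x∉xs)))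
  split (no a≢x)   = 𝟙-cong (a ∈? x ∷ xs) (a ∈? xs)
    (λ { (here a≡x) → ⊥-elim (a≢x a≡x) ; (there a∈xs) → a∈xs }) there

∑-𝟙≟ : ∀ (g : ℕ → ℕ) {x} N → x < N → ∑[ a < N ] 𝟙 (a ≟ x) * g a ≡ g x
∑-𝟙≟ g {x} (suc N) x<1+N with m≤n⇒m<n∨m≡n (s≤s⁻¹ x<1+N)
... | inj₁ x<N  = trans (cong₂ _+_ (∑-𝟙≟ g N x<N) (cong (_* g N) (𝟙-no (N ≟ x) (>⇒≢ x<N))))
                        (+-identityʳ (g x))
... | inj₂ refl = trans (cong₂ _+_ (∑-zero x (λ a a<x → cong (_* g a) (𝟙-no (a ≟ x) (<⇒≢ a<x))))
                                  (cong (_* g x) (𝟙-yes (x ≟ x) refl)))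
                        (+-identityʳ (g x))

sum-map≡∑𝟙∈ : ∀ (f : ℕ → ℕ) {N} {xs} → Unique xs → All (_< N) xs →
              sum (map f xs) ≡ ∑[ a < N ] 𝟙 (a ∈? xs) * f a
sum-map≡∑𝟙∈ f {N} {[]}     []            []           = sym (∑-zero N (λ _ _ → refl))
sum-map≡∑𝟙∈ f {N} {x ∷ xs} (x∉xs ∷ uniq) (x<N ∷ xs<N) = begin
  f x + sum (map f xs)
    ≡⟨ cong₂ _+_ (∑-𝟙≟ f N x<N) (sym (sum-map≡∑𝟙∈ f uniq xs<N)) ⟨
  ∑[ a < N ] 𝟙 (a ≟ x) * f a + ∑[ a < N ] 𝟙 (a ∈? xs) * f a
    ≡⟨ ∑-distrib-+ _ _ N ⟨
  ∑[ a < N ] (𝟙 (a ≟ x) * f a + 𝟙 (a ∈? xs) * f a)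
    ≡⟨ ∑-cong N (λ a _ → trans (sym (*-distribʳ-+ (f a) (𝟙 (a ≟ x)) _))
                               (cong (_* f a) (sym (𝟙-∈-∷ a (All¬⇒¬Any x∉xs))))) ⟩
  ∑[ a < N ] 𝟙 (a ∈? x ∷ xs) * f a
    ∎
  where open ≡-Reasoning

count : ∀ {p} {P : ℕ → Set p} → Decidable P → List ℕ → ℕ
count P? xs = sum (map (λ x → 𝟙 (P? x)) xs)

module _ {p} {P : ℕ → Set p} (P? : Decidable P) where

  length-filter≡count : ∀ xs → length (filter P? xs) ≡ count P? xs
  length-filter≡count []       = refl
  length-filter≡count (x ∷ xs) with P? x
  ... | yes _ = cong suc (length-filter≡count xs)
  ... | no _  = length-filter≡count xs

  length-filter-applyUpTo : ∀ g n → length (filter P? (applyUpTo g n)) ≡ ∑[ a < n ] 𝟙 (P? (g a))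
  length-filter-applyUpTo g n = begin
    length (filter P? (applyUpTo g n))      ≡⟨ length-filter≡count (applyUpTo g n) ⟩
    sum (map (𝟙 ∘ P?) (applyUpTo g n))      ≡⟨ cong sum (map-applyUpTo g (𝟙 ∘ P?) n) ⟩
    sum (applyUpTo (𝟙 ∘ P? ∘ g) n)          ≡⟨ sum-applyUpTo (𝟙 ∘ P? ∘ g) n ⟩
    ∑[ a < n ] 𝟙 (P? (g a))                 ∎
    where open ≡-Reasoning

  count-all : ∀ {xs} → All P xs → count P? xs ≡ length xs
  count-all []                 = refl
  count-all {x ∷ _} (px ∷ pxs) = cong₂ _+_ (𝟙-yes (P? x) px) (count-all pxs)

  count-none : ∀ {xs} → All (¬_ ∘ P) xs → count P? xs ≡ 0
  count-none []                   = refl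
  count-none {x ∷ _} (¬px ∷ ¬pxs) = cong₂ _+_ (𝟙-no (P? x) ¬px) (count-none ¬pxs)

count≤length : ∀ {p} {P : ℕ → Set p} (P? : Decidable P) xs → count P? xs ≤ length xs
count≤length P? xs = subst (_≤ length xs) (length-filter≡count P? xs) (length-filter P? xs)

count-<+count-> : ∀ c xs → c ∉ xs → count (_<? c) xs + count (c <?_) xs ≡ length xs
count-<+count-> c []       _    = refl
count-<+count-> c (y ∷ ys) c∉ = begin
  𝟙 (y <? c) + count (_<? c) ys + (𝟙 (c <? y) + count (c <?_) ys)
    ≡⟨ regroup (𝟙 (y <? c)) (count (_<? c) ys) (𝟙 (c <? y)) (count (c <?_) ys) ⟩
  (𝟙 (y <? c) + 𝟙 (c <? y)) + (count (_<? c) ys + count (c <?_) ys)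
    ≡⟨ cong₂ _+_ exactly-one (count-<+count-> c ys (c∉ ∘ there)) ⟩
  suc (length ys)
    ∎
  where
  open ≡-Reasoning
  regroup : ∀ u a v b → u + a + (v + b) ≡ (u + v) + (a + b)
  regroup = solve-∀
  exactly-one : 𝟙 (y <? c) + 𝟙 (c <? y) ≡ 1
  exactly-one with <-cmp y c
  ... | tri< y<c _ c≮y = cong₂ _+_ (𝟙-yes (y <? c) y<c) (𝟙-no (c <? y) c≮y)
  ... | tri≈ _ y≡c _   = ⊥-elim (c∉ (here (sym y≡c)))
  ... | tri> y≮c _ c<y = cong₂ _+_ (𝟙-no (y <? c) y≮c) (𝟙-yes (c <? y) c<y)

-- Strictly decreasing lists

Decreasing : List ℕ → Set
Decreasing = AllPairs _>_

reverse-decreasing : ∀ {xs} → AllPairs _<_ xs → Decreasing (reverse xs)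
reverse-decreasing {[]}     []           = []
reverse-decreasing {x ∷ xs} (x<xs ∷ inc) = subst Decreasing (sym (unfold-reverse x xs))
  (AllPairsP.++⁺ (reverse-decreasing inc) ([] ∷ [])
     (All.tabulate (λ y∈ → All.lookup x<xs (AnyP.reverse⁻ y∈) ∷ [])))

∈⇒≤head : ∀ {y ys z} → Decreasing (y ∷ ys) → z ∈ y ∷ ys → z ≤ y
∈⇒≤head _          (here refl) = ≤-refl
∈⇒≤head (y>ys ∷ _) (there z∈ys) = <⇒≤ (All.lookup y>ys z∈ys)

nth-0-maximum : ∀ {rs m} → Decreasing rs → m ∈ rs → (∀ {z} → z ∈ rs → z ≤ m) → nth rs 0 ≡ m
nth-0-maximum {y ∷ ys} dec m∈rs ≤m = ≤-antisym (≤m (here refl)) (∈⇒≤head dec m∈rs)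

count-<-nth : ∀ {rs} → Decreasing rs → ∀ {j} → j < length rs → count (_<? nth rs j) rs ≡ length rs ∸ suc j
count-<-nth {y ∷ ys} (y>ys ∷ _)   {zero}  _         =
  cong₂ _+_ (𝟙-no (y <? y) (<-irrefl refl)) (count-all (_<? y) y>ys)
count-<-nth {y ∷ ys} (y>ys ∷ dec) {suc j} (s≤s j<n) =
  cong₂ _+_ (𝟙-no (y <? nth ys j) (<-asym (All.lookup y>ys (nth∈ ys j<n)))) (count-<-nth dec j<n)

count->⇒<-nth : ∀ {x rs} → Decreasing rs → ∀ {j} → j < count (x <?_) rs → x < nth rs j
count->⇒<-nth {x} {y ∷ ys} (y>ys ∷ dec) {j} = split (x <? y) j
  where
  split : (d : Dec (x < y)) → ∀ j → j < 𝟙 d + count (x <?_) ys → x < nth (y ∷ ys) j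
  split (yes x<y) zero    _         = x<y
  split (yes _)   (suc j) (s≤s j<c) = count->⇒<-nth dec j<c
  split (no x≮y)  j       j<c       = ⊥-elim (n≮0 (subst (j <_) none-above j<c))
    where
    none-above : count (x <?_) ys ≡ 0
    none-above = count-none (x <?_) (All.map (λ z<y x<z → x≮y (<-trans x<z z<y)) y>ys)

count->≤⇒nth-≤ : ∀ {x rs} → Decreasing rs → ∀ {j} → count (x <?_) rs ≤ j → j < length rs →
                 nth rs j ≤ x
count->≤⇒nth-≤ {x} {y ∷ ys} (y>ys ∷ dec) {j} = split (x <? y) j
  where
  split : (d : Dec (x < y)) → ∀ j → 𝟙 d + count (x <?_) ys ≤ j → j < length (y ∷ ys) →
          nth (y ∷ ys) j ≤ x
  split (yes _)  (suc j) (s≤s c≤j) (s≤s j<n) = count->≤⇒nth-≤ dec c≤j j<n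
  split (no x≮y) j       _         j<n       =
    ≤-trans (∈⇒≤head (y>ys ∷ dec) (nth∈ (y ∷ ys) j<n)) (≮⇒≥ x≮y)

sum-map-∸-decreasing : ∀ c {rs} → Decreasing rs →
                       sum (map (_∸ c) rs) ≡ ∑[ j < count (c <?_) rs ] (nth rs j ∸ c)
sum-map-∸-decreasing c {rs} dec = begin
  sum (map (_∸ c) rs)
    ≡⟨ sum-map-nth (_∸ c) rs ⟩
  ∑[ j < length rs ] (nth rs j ∸ c)
    ≡⟨ cong (λ n → ∑[ j < n ] (nth rs j ∸ c)) (m+[n∸m]≡n q≤n) ⟨
  ∑[ j < q + (length rs ∸ q) ] (nth rs j ∸ c)
    ≡⟨ ∑-split (λ j → nth rs j ∸ c) q (length rs ∸ q) ⟩
  ∑[ j < q ] (nth rs j ∸ c) + ∑[ a < length rs ∸ q ] (nth rs (q + a) ∸ c)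
    ≡⟨ cong (∑[ j < q ] (nth rs j ∸ c) +_) (∑-zero (length rs ∸ q) below) ⟩
  ∑[ j < q ] (nth rs j ∸ c) + 0
    ≡⟨ +-identityʳ (∑[ j < q ] (nth rs j ∸ c)) ⟩
  ∑[ j < q ] (nth rs j ∸ c)
    ∎
  where
  open ≡-Reasoning
  q = count (c <?_) rs
  q≤n : q ≤ length rs
  q≤n = count≤length (c <?_) rs
  below : ∀ a → a < length rs ∸ q → nth rs (q + a) ∸ c ≡ 0
  below a a<n∸q = m≤n⇒m∸n≡0 (count->≤⇒nth-≤ dec (m≤m+n q a)
                    (subst (q + a <_) (m+[n∸m]≡n q≤n) (+-monoʳ-< q a<n∸q)))

-- The Young diagram of a partition into distinct parts

hookColSum≡∑ : ∀ ps z col → hookColSum ps z col ≡ ∑[ d < z ∸ 1 ] hook ps (2 + d) col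
hookColSum≡∑ ps z col = trans (cong sum (map-upTo (λ d → hook ps (2 + d) col) (z ∸ 1)))
                              (sum-applyUpTo (λ d → hook ps (2 + d) col) (z ∸ 1))

module DistinctPartition {ps : List ℕ} (dp : IsDistinctPartition ps) where

  L t : ℕ
  L = largest ps
  t = length ps

  rs : List ℕ
  rs = reverse ps

  -- χ and ν are the indicator functions of λ and of S_λ = ℕ₀ ∖ λ.
  χ ν : ℕ → ℕ
  χ a = 𝟙 (a ∈? ps)
  ν a = 𝟙 (¬? (a ∈? ps))

  ν+χ≡1 : ∀ a → ν a + χ a ≡ 1
  ν+χ≡1 a = 𝟙-¬+𝟙 (a ∈? ps)

  χ≤1 : ∀ a → χ a ≤ 1
  χ≤1 a = 𝟙≤1 (a ∈? ps)

  ν≤1 : ∀ a → ν a ≤ 1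
  ν≤1 a = 𝟙≤1 (¬? (a ∈? ps))

  ∑ν+∑χ : ∀ n → ∑ n ν + ∑ n χ ≡ n
  ∑ν+∑χ n = begin
    ∑ n ν + ∑ n χ           ≡⟨ ∑-distrib-+ ν χ n ⟨
    ∑[ a < n ] (ν a + χ a)  ≡⟨ ∑-cong n (λ a _ → ν+χ≡1 a) ⟩
    ∑[ _ < n ] 1            ≡⟨ trans (∑-const 1 n) (*-identityʳ n) ⟩
    n                       ∎
    where open ≡-Reasoning

  increasing : AllPairs _<_ ps
  increasing = Linked⇒AllPairs <-trans (proj₁ dp)

  ≤largest : ∀ {x} → x ∈ ps → x ≤ L
  ≤largest = ∈⇒≤largest ps

  0∉ : 0 ∉ ps
  0∉ 0∈ps with All.lookup (proj₁ (proj₂ dp)) 0∈ps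
  ... | ()

  largest∈ : L ∈ ps
  largest∈ with foldr-selective ⊔-sel 0 ps
  ... | inj₂ L∈ps = L∈ps
  ... | inj₁ L≡0  =
    ⊥-elim (0∉ (subst (_∈ ps) (n≤0⇒n≡0 (subst (nth ps 0 ≤_) L≡0 (≤largest x∈ps))) x∈ps))
    where
    x∈ps = nth∈ ps (≤-trans (s≤s z≤n) (proj₂ (proj₂ dp)))

  sum-map≡∑χ : ∀ (f : ℕ → ℕ) {N} → L < N → sum (map f ps) ≡ ∑[ a < N ] χ a * f a
  sum-map≡∑χ f L<N = sum-map≡∑𝟙∈ f (AllPairs.map <⇒≢ increasing)
                       (All.tabulate (λ x∈ps → ≤-<-trans (≤largest x∈ps) L<N))

  sum≡∑χ : sum ps ≡ ∑[ a < suc L ] χ a * a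
  sum≡∑χ = trans (cong sum (sym (map-id ps))) (sum-map≡∑χ id ≤-refl)

  length≡∑χ : t ≡ ∑ (suc L) χ
  length≡∑χ = begin
    length ps                         ≡⟨ length-as-sum ps ⟩
    sum (map (λ _ → 1) ps)            ≡⟨ sum-map≡∑χ (λ _ → 1) ≤-refl ⟩
    ∑[ a < suc L ] χ a * 1            ≡⟨ ∑-cong (suc L) (λ a _ → *-identityʳ (χ a)) ⟩
    ∑ (suc L) χ                       ∎
    where
    open ≡-Reasoning
    length-as-sum : ∀ (xs : List ℕ) → length xs ≡ sum (map (λ _ → 1) xs)
    length-as-sum []       = refl
    length-as-sum (_ ∷ xs) = cong suc (length-as-sum xs)

  1+numMissing≡∑ν : suc (numMissing ps) ≡ ∑ (suc L) ν
  1+numMissing≡∑ν = begin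
    suc (numMissing ps)
      ≡⟨ cong (λ xs → suc (length (filter (λ m → ¬? (m ∈? ps)) xs))) (map-upTo suc L) ⟩
    suc (length (filter (λ m → ¬? (m ∈? ps)) (applyUpTo suc L)))
      ≡⟨ cong suc (length-filter-applyUpTo (λ m → ¬? (m ∈? ps)) suc L) ⟩
    1 + ∑[ a < L ] ν (suc a)
      ≡⟨ cong (_+ ∑[ a < L ] ν (suc a)) (𝟙-yes (¬? (0 ∈? ps)) 0∉) ⟨
    ν 0 + ∑[ a < L ] ν (suc a)
      ≡⟨ ∑-unfoldˡ ν L ⟨
    ∑ (suc L) ν
      ∎
    where open ≡-Reasoning

  rs-decreasing : Decreasing rs
  rs-decreasing = reverse-decreasing increasing

  sum-map-rs : ∀ (f : ℕ → ℕ) → sum (map f rs) ≡ sum (map f ps)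
  sum-map-rs f = trans (cong sum (reverse-map f ps)) (sum-↭ (↭-reverse (map f ps)))

  length-rs : length rs ≡ t
  length-rs = length-reverse ps

  ∑χ≡count< : ∀ x → ∑ x χ ≡ count (_<? x) rs
  ∑χ≡count< x = sym (begin
    count (_<? x) rs                          ≡⟨ sum-map-rs (λ y → 𝟙 (y <? x)) ⟩
    sum (map (λ y → 𝟙 (y <? x)) ps)           ≡⟨ sum-map≡∑χ (λ y → 𝟙 (y <? x)) (m≤n+m (suc L) x) ⟩
    ∑[ a < x + suc L ] χ a * 𝟙 (a <? x)       ≡⟨ ∑-split (λ a → χ a * 𝟙 (a <? x)) x (suc L) ⟩
    ∑[ a < x ] χ a * 𝟙 (a <? x) + ∑[ a < suc L ] χ (x + a) * 𝟙 (x + a <? x)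
                                              ≡⟨ cong₂ _+_ below above ⟩
    ∑ x χ + 0                                 ≡⟨ +-identityʳ (∑ x χ) ⟩
    ∑ x χ                                     ∎)
    where
    open ≡-Reasoning
    below : ∑[ a < x ] χ a * 𝟙 (a <? x) ≡ ∑ x χ
    below = ∑-cong x (λ a a<x → trans (cong (χ a *_) (𝟙-yes (a <? x) a<x)) (*-identityʳ (χ a)))
    above : ∑[ a < suc L ] χ (x + a) * 𝟙 (x + a <? x) ≡ 0
    above = ∑-zero (suc L) (λ a _ →
      trans (cong (χ (x + a) *_) (𝟙-no (x + a <? x) (m+n≮m x a))) (*-zeroʳ (χ (x + a))))

  rowLen≡∑ν : ∀ i → rowLen ps i ≡ ∑ (rowPart ps i) ν
  rowLen≡∑ν i = length-filter-applyUpTo (λ s → ¬? (s ∈? ps)) id (rowPart ps i)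

  rowLen+rank : ∀ {j} → j < t → rowLen ps (suc j) + (t ∸ suc j) ≡ nth rs j
  rowLen+rank {j} j<t = begin
    rowLen ps (suc j) + (t ∸ suc j)
      ≡⟨ cong₂ _+_ (rowLen≡∑ν (suc j)) (cong (_∸ suc j) (sym length-rs)) ⟩
    ∑ (nth rs j) ν + (length rs ∸ suc j)
      ≡⟨ cong (∑ (nth rs j) ν +_) (count-<-nth rs-decreasing j<length) ⟨
    ∑ (nth rs j) ν + count (_<? nth rs j) rs
      ≡⟨ cong (∑ (nth rs j) ν +_) (∑χ≡count< (nth rs j)) ⟨
    ∑ (nth rs j) ν + ∑ (nth rs j) χ
      ≡⟨ ∑ν+∑χ (nth rs j) ⟩
    nth rs j
      ∎
    where
    open ≡-Reasoning
    j<length : j < length rs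
    j<length = subst (j <_) (sym length-rs) j<t

  rowPart-1≡largest : rowPart ps 1 ≡ L
  rowPart-1≡largest = nth-0-maximum rs-decreasing (AnyP.reverse⁺ largest∈) (≤largest ∘ AnyP.reverse⁻)

  leg≡∑ : ∀ i j → leg ps i j ≡ ∑[ d < t ∸ i ] 𝟙 (j ≤? rowLen ps (i + suc d))
  leg≡∑ i j = trans
    (cong (λ rows → length (filter (λ i′ → j ≤? rowLen ps i′) rows)) (map-upTo (λ d → i + suc d) (t ∸ i)))
    (length-filter-applyUpTo (λ i′ → j ≤? rowLen ps i′) (λ d → i + suc d) (t ∸ i))

  hook-decreasing : ∀ i {j j′} → j < j′ → j′ ≤ rowLen ps i → hook ps i j′ < hook ps i j
  hook-decreasing i {j} {j′} j<j′ j′≤R = +-monoˡ-≤ 1 (+-mono-<-≤ (∸-monoʳ-< j<j′ j′≤R) leg-mono)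
    where
    leg-mono : leg ps i j′ ≤ leg ps i j
    leg-mono = subst₂ _≤_ (sym (leg≡∑ i j′)) (sym (leg≡∑ i j))
      (∑-mono-≤ (t ∸ i) (λ d _ →
        𝟙-mono (j′ ≤? rowLen ps (i + suc d)) (j ≤? rowLen ps (i + suc d)) (≤-trans (<⇒≤ j<j′))))

  hook-injective : ∀ i {z z′} → suc z ≤ rowLen ps i → suc z′ ≤ rowLen ps i →
                   hook ps i (suc z) ≡ hook ps i (suc z′) → z ≡ z′
  hook-injective i {z} {z′} z<R z′<R eq with <-cmp z z′
  ... | tri< z<z′ _ _ = ⊥-elim (<-irrefl (sym eq) (hook-decreasing i (s≤s z<z′) z′<R))
  ... | tri≈ _ z≡z′ _ = z≡z′
  ... | tri> _ _ z′<z = ⊥-elim (<-irrefl eq (hook-decreasing i (s≤s z′<z) z<R))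

  -- For a gap c ∈ S_λ, column p + 1 of Y_{S_λ} is the one indexed by c, and rows 1, …, q are
  -- those of the parts exceeding c.
  module Gap {c : ℕ} (c∉ps : c ∉ ps) where

    p q : ℕ
    p = ∑ c ν
    q = count (c <?_) rs

    c∉rs : c ∉ rs
    c∉rs = c∉ps ∘ AnyP.reverse⁻

    q≤t : q ≤ t
    q≤t = subst (q ≤_) length-rs (count≤length (c <?_) rs)

    p+[t∸q]≡c : p + (t ∸ q) ≡ c
    p+[t∸q]≡c = begin
      ∑ c ν + (t ∸ q)                      ≡⟨ cong (λ n → ∑ c ν + (n ∸ q)) length-rs ⟨
      ∑ c ν + (length rs ∸ q)              ≡⟨ cong (λ n → ∑ c ν + (n ∸ q)) (count-<+count-> c rs c∉rs) ⟨
      ∑ c ν + (count (_<? c) rs + q ∸ q)   ≡⟨ cong (∑ c ν +_) (m+n∸n≡m (count (_<? c) rs) q) ⟩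
      ∑ c ν + count (_<? c) rs             ≡⟨ cong (∑ c ν +_) (∑χ≡count< c) ⟨
      ∑ c ν + ∑ c χ                        ≡⟨ ∑ν+∑χ c ⟩
      c                                    ∎
      where open ≡-Reasoning

    c<L⇒0<q : c < L → 0 < q
    c<L⇒0<q c<L = ≰⇒> (λ q≤0 → <⇒≱ c<L (subst (_≤ c) rowPart-1≡largest (count->≤⇒nth-≤ rs-decreasing q≤0 0<length)))
      where
      0<length : 0 < length rs
      0<length = subst (0 <_) (sym length-rs) (≤-trans (s≤s z≤n) (proj₂ (proj₂ dp)))

    rowLen-above : ∀ {j} → j < q → suc p ≤ rowLen ps (suc j)
    rowLen-above {j} j<q = begin
      suc (∑ c ν)          ≡⟨ cong suc (+-identityʳ (∑ c ν)) ⟨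
      suc (∑ c ν + 0)      ≡⟨ +-suc (∑ c ν) 0 ⟨
      ∑ c ν + 1            ≡⟨ cong (∑ c ν +_) (𝟙-yes (¬? (c ∈? ps)) c∉ps) ⟨
      ∑ (suc c) ν          ≤⟨ ∑-monoˡ-≤ ν (count->⇒<-nth rs-decreasing j<q) ⟩
      ∑ (nth rs j) ν       ≡⟨ rowLen≡∑ν (suc j) ⟨
      rowLen ps (suc j)    ∎
      where open ≤-Reasoning

    rowLen-below : ∀ {j} → q ≤ j → j < t → rowLen ps (suc j) ≤ p
    rowLen-below {j} q≤j j<t = subst (_≤ p) (sym (rowLen≡∑ν (suc j)))
      (∑-monoˡ-≤ ν (count->≤⇒nth-≤ rs-decreasing q≤j (subst (j <_) (sym length-rs) j<t)))

    leg-at-gap : ∀ {i} → i ≤ q → leg ps i (suc p) ≡ q ∸ i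
    leg-at-gap {i} i≤q = begin
      leg ps i (suc p)                                      ≡⟨ leg≡∑ i (suc p) ⟩
      ∑[ d < t ∸ i ] 𝟙 (suc p ≤? rowLen ps (i + suc d))     ≡⟨ ∑-cong (t ∸ i) row-above⇔ ⟩
      ∑[ d < t ∸ i ] 𝟙 (d <? q ∸ i)                         ≡⟨ ∑-𝟙<? (t ∸ i) (∸-monoˡ-≤ i q≤t) ⟩
      q ∸ i                                                 ∎
      where
      open ≡-Reasoning
      row-above⇔ : ∀ d → d < t ∸ i → 𝟙 (suc p ≤? rowLen ps (i + suc d)) ≡ 𝟙 (d <? q ∸ i)
      row-above⇔ d d<t∸i rewrite +-suc i d = 𝟙-cong (suc p ≤? rowLen ps (suc (i + d))) (d <? q ∸ i)
        (λ above → o+m<n⇒m<n∸o (≰⇒> (λ q≤i+d → <⇒≱ above (rowLen-below q≤i+d i+d<t))))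
        (λ d<q∸i → rowLen-above (m<n∸o⇒o+m<n i≤q d<q∸i))
        where
        i+d<t : i + d < t
        i+d<t = m<n∸o⇒o+m<n (≤-trans i≤q q≤t) d<t∸i

    hook-at-gap : ∀ {j} → j < q → hook ps (suc j) (suc p) ≡ nth rs j ∸ c
    hook-at-gap {j} j<q = begin
      rowLen ps (suc j) ∸ suc p + leg ps (suc j) (suc p) + 1
        ≡⟨ cong (λ l → rowLen ps (suc j) ∸ suc p + l + 1) (leg-at-gap j<q) ⟩
      rowLen ps (suc j) ∸ suc p + (q ∸ suc j) + 1
        ≡⟨ rearrange (rowLen-above j<q) j<q q≤t ⟩
      (rowLen ps (suc j) + (t ∸ suc j)) ∸ (p + (t ∸ q))
        ≡⟨ cong₂ _∸_ (rowLen+rank (<-≤-trans j<q q≤t)) p+[t∸q]≡c ⟩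
      nth rs j ∸ c
        ∎
      where
      open ≡-Reasoning
      rearrange : ∀ {R a b i n} → suc a ≤ R → i ≤ b → b ≤ n →
                  R ∸ suc a + (b ∸ i) + 1 ≡ (R + (n ∸ i)) ∸ (a + (n ∸ b))
      rearrange {a = a} {i = i} a<R i≤b b≤n
        with u , refl ← m≤n⇒∃[o]m+o≡n a<R
           | v , refl ← m≤n⇒∃[o]m+o≡n i≤b
           | w , refl ← m≤n⇒∃[o]m+o≡n b≤n = begin
        suc a + u ∸ suc a + (i + v ∸ i) + 1
          ≡⟨ cong₂ (λ x y → x + y + 1) (m+n∸m≡n (suc a) u) (m+n∸m≡n i v) ⟩
        u + v + 1
          ≡⟨ m+n∸m≡n (a + w) (u + v + 1) ⟨
        (a + w + (u + v + 1)) ∸ (a + w)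
          ≡⟨ cong₂ _∸_ (shuffle a w u v) (cong (a +_) (m+n∸m≡n (i + v) w)) ⟨
        (suc a + u + (v + w)) ∸ (a + (i + v + w ∸ (i + v)))
          ≡⟨ cong (λ x → (suc a + u + x) ∸ (a + (i + v + w ∸ (i + v))))
                  (trans (cong (_∸ i) (+-assoc i v w)) (m+n∸m≡n i (v + w))) ⟨
        (suc a + u + (i + v + w ∸ i)) ∸ (a + (i + v + w ∸ (i + v)))
          ∎
        where
        shuffle : ∀ a w u v → suc a + u + (v + w) ≡ a + w + (u + v + 1)
        shuffle = solve-∀

    hookColSum-at-gap : 0 < q → (L ∸ c) + hookColSum ps q (suc p) ≡ sum (map (_∸ c) ps)
    hookColSum-at-gap 0<q = begin
      (L ∸ c) + hookColSum ps q (suc p)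
        ≡⟨ cong₂ _+_ (cong (_∸ c) rowPart-1≡largest) (sym (hookColSum≡∑ ps q (suc p))) ⟨
      (nth rs 0 ∸ c) + ∑[ d < q ∸ 1 ] hook ps (2 + d) (suc p)
        ≡⟨ cong ((nth rs 0 ∸ c) +_) (∑-cong (q ∸ 1) (λ _ d<q∸1 → hook-at-gap (m<n∸o⇒o+m<n 0<q d<q∸1))) ⟩
      (nth rs 0 ∸ c) + ∑[ d < q ∸ 1 ] (nth rs (suc d) ∸ c)
        ≡⟨ ∑-unfoldˡ (λ j → nth rs j ∸ c) (q ∸ 1) ⟨
      ∑[ j < suc (q ∸ 1) ] (nth rs j ∸ c)
        ≡⟨ cong (λ n → ∑[ j < n ] (nth rs j ∸ c)) (m+[n∸m]≡n 0<q) ⟩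
      ∑[ j < q ] (nth rs j ∸ c)
        ≡⟨ sum-map-∸-decreasing c rs-decreasing ⟨
      sum (map (_∸ c) rs)
        ≡⟨ sum-map-rs (_∸ c) ⟩
      sum (map (_∸ c) ps)
        ∎
      where open ≡-Reasoning

  -- lo d and up d = L − lo d (d < c) run through the pairs {a, L − a} with a < L/2; when r = 1
  -- the middle c = L/2 is unpaired.  The 1 + in 1+#M≡ counts 0 ∈ S_λ.
  module Complementary (unref : Unrefinable ps) {c r : ℕ} (r≤1 : r ≤ 1)
                       (1+L≡ : suc L ≡ c + r + c) (1+#M≡ : suc (numMissing ps) ≡ r + c) where

    lo up : ℕ → ℕ
    lo d = c ∸ suc d
    up d = c + r + d

    lo+up≡L : ∀ {d} → d < c → lo d + up d ≡ L
    lo+up≡L {d} d<c = suc-injective (begin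
      suc (lo d + up d)         ≡⟨ shuffle (lo d) c r d ⟩
      c + r + (lo d + suc d)    ≡⟨ cong (c + r +_) (m∸n+n≡m d<c) ⟩
      c + r + c                 ≡⟨ 1+L≡ ⟨
      suc L                     ∎)
      where
      open ≡-Reasoning
      shuffle : ∀ x c r d → suc (x + (c + r + d)) ≡ c + r + (x + suc d)
      shuffle = solve-∀

    lo<c : ∀ {d} → d < c → lo d < c
    lo<c {d} d<c = subst (lo d <_) (m∸n+n≡m d<c) (m<m+n (lo d) z<s)

    lo<up : ∀ {d} → d < c → lo d < up d
    lo<up {d} d<c = <-≤-trans (lo<c d<c) (≤-trans (m≤m+n c r) (m≤m+n (c + r) d))

    not-both-missing : ∀ {d} → d < c → lo d ∉ ps → up d ∉ ps → ⊥
    not-both-missing {d} d<c lo∉ up∉ with lo d ≟ 0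
    ... | yes lo≡0 = up∉ (subst (_∈ ps) (trans (sym (lo+up≡L d<c)) (cong (_+ up d) lo≡0)) largest∈)
    ... | no lo≢0  = unref (lo d) (up d) (<⇒≢ (lo<up d<c))
                       (n≢0⇒n>0 lo≢0 , lo≤L , lo∉)
                       (<-≤-trans (n≢0⇒n>0 lo≢0) (<⇒≤ (lo<up d<c)) , up≤L , up∉)
                       (subst (_∈ ps) (sym (lo+up≡L d<c)) largest∈)
      where
      lo≤L : lo d ≤ L
      lo≤L = subst (lo d ≤_) (lo+up≡L d<c) (m≤m+n (lo d) (up d))
      up≤L : up d ≤ L
      up≤L = subst (up d ≤_) (lo+up≡L d<c) (m≤n+m (up d) (lo d))

    ν-pair≤1 : ∀ {d} → d < c → ν (lo d) + ν (up d) ≤ 1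
    ν-pair≤1 {d} d<c = bound (lo d ∈? ps) (up d ∈? ps)
      where
      bound : (x : Dec (lo d ∈ ps)) (y : Dec (up d ∈ ps)) → 𝟙 (¬? x) + 𝟙 (¬? y) ≤ 1
      bound (yes _)   (yes _)   = z≤n
      bound (yes _)   (no _)    = ≤-refl
      bound (no _)    (yes _)   = ≤-refl
      bound (no lo∉) (no up∉) = ⊥-elim (not-both-missing d<c lo∉ up∉)

    middle pairs : ℕ
    middle = ∑[ a < r ] ν (c + a)
    pairs  = ∑[ d < c ] (ν (lo d) + ν (up d))

    middle+pairs≡r+c : middle + pairs ≡ r + c
    middle+pairs≡r+c = begin
      middle + pairs         ≡⟨ ∑-fold ν c r ⟨
      ∑ (c + r + c) ν        ≡⟨ cong (λ n → ∑ n ν) 1+L≡ ⟨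
      ∑ (suc L) ν            ≡⟨ 1+numMissing≡∑ν ⟨
      suc (numMissing ps)    ≡⟨ 1+#M≡ ⟩
      r + c                  ∎
      where open ≡-Reasoning

    ν-pair≡1 : ∀ {d} → d < c → ν (lo d) + ν (up d) ≡ 1
    ν-pair≡1 {d} = ∑-≤1-saturated c (λ _ → ν-pair≤1) c≤pairs d
      where
      c≤pairs : c ≤ pairs
      c≤pairs = +-cancelˡ-≤ r c pairs (≤-trans (≤-reflexive (sym middle+pairs≡r+c))
                  (+-monoˡ-≤ pairs (∑-≤1⇒≤n r (λ a _ → ν≤1 (c + a)))))

    middle∉ : r ≡ 1 → c ∉ ps
    middle∉ refl c∈ps = 𝟙>0⇒ (¬? (c + 0 ∈? ps)) 1≤middle (subst (_∈ ps) (sym (+-identityʳ c)) c∈ps)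
      where
      1≤middle : 1 ≤ middle
      1≤middle = +-cancelʳ-≤ c 1 middle (≤-trans (≤-reflexive (sym middle+pairs≡r+c))
                   (+-monoʳ-≤ middle (∑-≤1⇒≤n c (λ _ → ν-pair≤1))))

    χ-pair : ∀ {d} → d < c → χ (lo d) + χ (up d) ≡ 1
    χ-pair {d} d<c = +-cancelˡ-≡ 1 (χ (lo d) + χ (up d)) 1 (begin
      1 + (χ (lo d) + χ (up d))                   ≡⟨ cong (_+ (χ (lo d) + χ (up d))) (ν-pair≡1 d<c) ⟨
      ν (lo d) + ν (up d) + (χ (lo d) + χ (up d))  ≡⟨ swap (ν (lo d)) (ν (up d)) (χ (lo d)) (χ (up d)) ⟩
      (ν (lo d) + χ (lo d)) + (ν (up d) + χ (up d)) ≡⟨ cong₂ _+_ (ν+χ≡1 (lo d)) (ν+χ≡1 (up d)) ⟩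
      2                                            ∎)
      where
      open ≡-Reasoning
      swap : ∀ a b x y → a + b + (x + y) ≡ (a + x) + (b + y)
      swap = solve-∀

    χ-middle : ∀ {a} → a < r → χ (c + a) ≡ 0
    χ-middle {a} a<r = 𝟙-no (c + a ∈? ps) (middle∉ r≡1 ∘ subst (_∈ ps) c+a≡c)
      where
      r≡1 : r ≡ 1
      r≡1 = ≤-antisym r≤1 (≤-trans (s≤s z≤n) a<r)
      c+a≡c : c + a ≡ c
      c+a≡c = trans (cong (c +_) (n<1⇒n≡0 (<-≤-trans a<r r≤1))) (+-identityʳ c)

    ∑χ-fold : ∀ (f : ℕ → ℕ) →
              ∑[ a < suc L ] χ a * f a ≡ ∑[ d < c ] (χ (lo d) * f (lo d) + χ (up d) * f (up d))
    ∑χ-fold f = begin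
      ∑[ a < suc L ] χ a * f a
        ≡⟨ cong (λ n → ∑[ a < n ] χ a * f a) 1+L≡ ⟩
      ∑[ a < c + r + c ] χ a * f a
        ≡⟨ ∑-fold (λ a → χ a * f a) c r ⟩
      ∑[ a < r ] χ (c + a) * f (c + a) + ∑[ d < c ] (χ (lo d) * f (lo d) + χ (up d) * f (up d))
        ≡⟨ cong (_+ ∑[ d < c ] (χ (lo d) * f (lo d) + χ (up d) * f (up d)))
                (∑-zero r (λ a a<r → cong (_* f (c + a)) (χ-middle a<r))) ⟩
      ∑[ d < c ] (χ (lo d) * f (lo d) + χ (up d) * f (up d))
        ∎
      where open ≡-Reasoning

    length≡c : t ≡ c
    length≡c = begin
      t                                          ≡⟨ length≡∑χ ⟩
      ∑ (suc L) χ                                ≡⟨ ∑-cong (suc L) (λ a _ → *-identityʳ (χ a)) ⟨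
      ∑[ a < suc L ] χ a * 1                     ≡⟨ ∑χ-fold (λ _ → 1) ⟩
      ∑[ d < c ] (χ (lo d) * 1 + χ (up d) * 1)   ≡⟨ ∑-cong c (λ d d<c → trans (pair-term d) (χ-pair d<c)) ⟩
      ∑[ d < c ] 1                               ≡⟨ trans (∑-const 1 c) (*-identityʳ c) ⟩
      c                                          ∎
      where
      open ≡-Reasoning
      pair-term : ∀ d → χ (lo d) * 1 + χ (up d) * 1 ≡ χ (lo d) + χ (up d)
      pair-term d = cong₂ _+_ (*-identityʳ (χ (lo d))) (*-identityʳ (χ (up d)))

    E : ℕ
    E = ∑[ d < c ] χ (up d) * (suc (d + d) + r)

    sum≡∑lo+E : sum ps ≡ ∑[ d < c ] lo d + E
    sum≡∑lo+E = begin
      sum ps                                            ≡⟨ sum≡∑χ ⟩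
      ∑[ a < suc L ] χ a * a                            ≡⟨ ∑χ-fold id ⟩
      ∑[ d < c ] (χ (lo d) * lo d + χ (up d) * up d)    ≡⟨ ∑-cong c pair-term ⟩
      ∑[ d < c ] (lo d + χ (up d) * (suc (d + d) + r))  ≡⟨ ∑-distrib-+ lo _ c ⟩
      ∑[ d < c ] lo d + E                               ∎
      where
      open ≡-Reasoning
      shuffle : ∀ x d r → x + suc d + r + d ≡ x + (suc (d + d) + r)
      shuffle = solve-∀
      up≡lo+gap : ∀ {d} → d < c → up d ≡ lo d + (suc (d + d) + r)
      up≡lo+gap {d} d<c = trans (cong (λ x → x + r + d) (sym (m∸n+n≡m d<c))) (shuffle (lo d) d r)
      pair-term : ∀ d → d < c → χ (lo d) * lo d + χ (up d) * up d ≡ lo d + χ (up d) * (suc (d + d) + r)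
      pair-term d d<c = trans (cong (λ u → χ (lo d) * lo d + χ (up d) * u) (up≡lo+gap d<c))
                              (one-of-pair {χ (lo d)} {χ (up d)} (lo d) (suc (d + d) + r) (χ-pair d<c))

    sum-formula : 2 * sum ps + c ≡ c * c + 2 * E
    sum-formula = begin
      2 * sum ps + c                           ≡⟨ cong (λ s → 2 * s + c) sum≡∑lo+E ⟩
      2 * (∑[ d < c ] lo d + E) + c            ≡⟨ regroup (∑[ d < c ] lo d) E c ⟩
      (2 * (∑[ d < c ] lo d) + c) + 2 * E      ≡⟨ cong (_+ 2 * E) (2*∑[c∸1+d]+c≡c*c c) ⟩
      c * c + 2 * E                            ∎
      where
      open ≡-Reasoning
      regroup : ∀ s e c → 2 * (s + e) + c ≡ (2 * s + c) + 2 * e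
      regroup = solve-∀

    excess-formula : sum (map (_∸ c) ps) ≡ ∑[ d < c ] χ (up d) * (r + d)
    excess-formula = begin
      sum (map (_∸ c) ps)                                         ≡⟨ sum-map≡∑χ (_∸ c) ≤-refl ⟩
      ∑[ a < suc L ] χ a * (a ∸ c)                                ≡⟨ ∑χ-fold (_∸ c) ⟩
      ∑[ d < c ] (χ (lo d) * (lo d ∸ c) + χ (up d) * (up d ∸ c))  ≡⟨ ∑-cong c (λ d d<c → cong₂ _+_ (lo-term d<c) up-term) ⟩
      ∑[ d < c ] χ (up d) * (r + d)                               ∎
      where
      open ≡-Reasoning
      lo-term : ∀ {d} → d < c → χ (lo d) * (lo d ∸ c) ≡ 0
      lo-term {d} d<c = trans (cong (χ (lo d) *_) (m≤n⇒m∸n≡0 (<⇒≤ (lo<c d<c)))) (*-zeroʳ (χ (lo d)))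
      up-term : ∀ {d} → χ (up d) * (up d ∸ c) ≡ χ (up d) * (r + d)
      up-term {d} = cong (χ (up d) *_) (trans (cong (_∸ c) (+-assoc c r d)) (m+n∸m≡n c (r + d)))

-- A large unrefinable partition

consecutive : ℕ → ℕ → List ℕ → List ℕ
consecutive s zero    tl = tl
consecutive s (suc n) tl = s ∷ consecutive (suc s) n tl

module _ {tl : List ℕ} where

  consecutive-linked : ∀ {s n x} → s + n ≤ x → Linked _<_ (x ∷ tl) → Linked _<_ (consecutive s n (x ∷ tl))
  consecutive-linked {s} {zero}        {x} _     lk = lk
  consecutive-linked {s} {suc zero}    {x} s+1≤x lk = subst (_≤ x) (+-comm s 1) s+1≤x ∷ lk
  consecutive-linked {s} {suc (suc n)} {x} s+n≤x lk =
    ≤-refl ∷ consecutive-linked {suc s} {suc n} (subst (_≤ x) (+-suc s (suc n)) s+n≤x) lk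

  consecutive-positive : ∀ {s} n → 1 ≤ s → All (1 ≤_) tl → All (1 ≤_) (consecutive s n tl)
  consecutive-positive zero    _   pos = pos
  consecutive-positive (suc n) 1≤s pos = 1≤s ∷ consecutive-positive n (m≤n⇒m≤1+n 1≤s) pos

  length-consecutive : ∀ s n → length (consecutive s n tl) ≡ n + length tl
  length-consecutive s zero    = refl
  length-consecutive s (suc n) = cong suc (length-consecutive (suc s) n)

  sum-consecutive : ∀ s n → 2 * sum (consecutive s n tl) + n ≡ n * (2 * s + n) + 2 * sum tl
  sum-consecutive s zero    = +-identityʳ _
  sum-consecutive s (suc n) = begin
    2 * (s + sum (consecutive (suc s) n tl)) + suc n      ≡⟨ regroup s (sum (consecutive (suc s) n tl)) n ⟩
    (2 * sum (consecutive (suc s) n tl) + n) + (2 * s + 1) ≡⟨ cong (_+ (2 * s + 1)) (sum-consecutive (suc s) n) ⟩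
    n * (2 * suc s + n) + 2 * sum tl + (2 * s + 1)         ≡⟨ expand s n (sum tl) ⟩
    suc n * (2 * s + suc n) + 2 * sum tl                   ∎
    where
    open ≡-Reasoning
    regroup : ∀ s x n → 2 * (s + x) + suc n ≡ (2 * x + n) + (2 * s + 1)
    regroup = solve-∀
    expand : ∀ s n y → n * (2 * suc s + n) + 2 * y + (2 * s + 1) ≡ suc n * (2 * s + suc n) + 2 * y
    expand = solve-∀

  ∈-consecutive⁺ : ∀ {s n a} → s ≤ a → a < s + n → a ∈ consecutive s n tl
  ∈-consecutive⁺ {s} {zero}  {a} s≤a a<s+0 = ⊥-elim (<⇒≱ (subst (a <_) (+-identityʳ s) a<s+0) s≤a)
  ∈-consecutive⁺ {s} {suc n} {a} s≤a a<s+n with m≤n⇒m<n∨m≡n s≤a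
  ... | inj₂ s≡a = here (sym s≡a)
  ... | inj₁ s<a = there (∈-consecutive⁺ s<a (subst (a <_) (+-suc s n) a<s+n))

  ∈-consecutive-tail : ∀ {s n a} → a ∈ tl → a ∈ consecutive s n tl
  ∈-consecutive-tail {n = zero}  a∈tl = a∈tl
  ∈-consecutive-tail {n = suc n} a∈tl = there (∈-consecutive-tail a∈tl)

  ∈-consecutive⁻ : ∀ {s n a} → a ∈ consecutive s n tl → a < s + n ⊎ a ∈ tl
  ∈-consecutive⁻ {s} {zero}  a∈tl        = inj₂ a∈tl
  ∈-consecutive⁻ {s} {suc n} (here refl) = inj₁ (m<m+n s z<s)
  ∈-consecutive⁻ {s} {suc n} {a} (there a∈) with ∈-consecutive⁻ a∈
  ... | inj₁ a<1+s+n = inj₁ (subst (a <_) (sym (+-suc s n)) a<1+s+n)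
  ... | inj₂ a∈tl    = inj₂ a∈tl

-- {1, …, n − 3, n + 1, 2n − 4} for n = 6 + m: its missing parts are all at least n − 2, so two
-- distinct ones add up to more than its largest part.
unrefinableWitness : ℕ → List ℕ
unrefinableWitness m = consecutive 1 (3 + m) (7 + m ∷ 8 + 2 * m ∷ [])

module _ (m : ℕ) where
  private
    qs = unrefinableWitness m

    7+m<8+2m : 7 + m < 8 + 2 * m
    7+m<8+2m = +-monoʳ-≤ 8 (m≤m+n m (m + 0))

  witness-distinct : IsDistinctPartition qs
  witness-distinct = consecutive-linked {s = 1} {3 + m} (s≤s (s≤s (s≤s (s≤s (m≤n+m m 3))))) (7+m<8+2m ∷ [-])
                   , consecutive-positive (3 + m) ≤-refl (s≤s z≤n ∷ s≤s z≤n ∷ [])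
                   , subst (2 ≤_) (sym (length-consecutive 1 (3 + m))) (m≤n+m 2 (3 + m))

  witness-sum : 2 * sum qs ≡ (6 + m) * (7 + m)
  witness-sum = +-cancelʳ-≡ (3 + m) (2 * sum qs) ((6 + m) * (7 + m))
    (trans (sum-consecutive 1 (3 + m)) (closed-form m))
    where
    closed-form : ∀ m → (3 + m) * (2 * 1 + (3 + m)) + 2 * (7 + m + (8 + 2 * m + 0)) ≡ (6 + m) * (7 + m) + (3 + m)
    closed-form = solve-∀

  witness-top : 8 + 2 * m ∈ qs
  witness-top = ∈-consecutive-tail {s = 1} {3 + m} (there (here refl))

  witness-≤top : ∀ {x} → x ∈ qs → x ≤ 8 + 2 * m
  witness-≤top x∈qs with ∈-consecutive⁻ {tl = 7 + m ∷ 8 + 2 * m ∷ []} {1} {3 + m} x∈qs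
  ... | inj₁ x<4+m               = ≤-trans (<⇒≤ x<4+m) (≤-trans (+-monoʳ-≤ 4 (m≤n+m m 3)) (<⇒≤ 7+m<8+2m))
  ... | inj₂ (here refl)         = <⇒≤ 7+m<8+2m
  ... | inj₂ (there (here refl)) = ≤-refl

  witness-unrefinable : Unrefinable qs
  witness-unrefinable a b a≢b (1≤a , _ , a∉qs) (1≤b , _ , b∉qs) a+b∈qs =
    <⇒≱ (subst (_≤ a + b) (expand m) (≢⇒k+k<a+b (large 1≤a a∉qs) (large 1≤b b∉qs) a≢b))
        (witness-≤top a+b∈qs)
    where
    large : ∀ {x} → 1 ≤ x → x ∉ qs → 4 + m ≤ x
    large {x} 1≤x x∉qs = ≮⇒≥ (λ x<4+m → x∉qs (∈-consecutive⁺ 1≤x x<4+m))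
    expand : ∀ m → suc ((4 + m) + (4 + m)) ≡ suc (8 + 2 * m)
    expand = solve-∀

maximal⇒8+2m≤largest : ∀ m {ps} → MaximalUnrefinable (T (6 + m)) ps → 8 + 2 * m ≤ largest ps
maximal⇒8+2m≤largest m (_ , _ , _ , maximal) =
  ≤-trans (∈⇒≤largest (unrefinableWitness m) (witness-top m))
          (maximal (unrefinableWitness m) (witness-distinct m) sum≡T (witness-unrefinable m))
  where
  sum≡T : sum (unrefinableWitness m) ≡ T (6 + m)
  sum≡T = trans (sym (m*n/n≡m (sum (unrefinableWitness m)) 2))
                (cong (_/ 2) (trans (*-comm (sum (unrefinableWitness m)) 2) (witness-sum m)))

-- Maximal unrefinable partitions of T (2k − 1) with ⌊λₜ/2⌋ missing parts

2*T[7+2j] : ∀ j → 2 * T (7 + 2 * j) ≡ (7 + 2 * j) * (8 + 2 * j)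
2*T[7+2j] j = begin
  2 * T (7 + 2 * j)                          ≡⟨ cong (λ x → 2 * (x / 2)) (halve j) ⟩
  2 * ((7 + 2 * j) * (4 + j) * 2 / 2)        ≡⟨ cong (2 *_) (m*n/n≡m ((7 + 2 * j) * (4 + j)) 2) ⟩
  2 * ((7 + 2 * j) * (4 + j))                ≡⟨ double j ⟩
  (7 + 2 * j) * (8 + 2 * j)                  ∎
  where
  open ≡-Reasoning
  halve : ∀ j → (7 + 2 * j) * (8 + 2 * j) ≡ (7 + 2 * j) * (4 + j) * 2
  halve = solve-∀
  double : ∀ j → 2 * ((7 + 2 * j) * (4 + j)) ≡ (7 + 2 * j) * (8 + 2 * j)
  double = solve-∀

-- With n = 7 + 2j and h = n − 2 + e: e = 0 is the solution, e = 1 contradicts parity, and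
-- e ≥ 2 makes the right-hand side too large.
even-case-arithmetic : ∀ j {h X} → 5 + 2 * j ≤ h → h ≤ X →
                       (7 + 2 * j) * (8 + 2 * j) + h ≡ h * h + 4 * X → h ≡ 5 + 2 * j × X ≡ 9 + 3 * j
even-case-arithmetic j {X = X} 5+2j≤h h≤X eq with e , refl ← m≤n⇒∃[o]m+o≡n 5+2j≤h = cases e h≤X eq
  where
  n = 7 + 2 * j
  cases : ∀ e → let h = 5 + 2 * j + e in
          h ≤ X → n * (1 + n) + h ≡ h * h + 4 * X → h ≡ 5 + 2 * j × X ≡ 9 + 3 * j
  cases zero _ eq = +-identityʳ (5 + 2 * j) ,
    *-cancelˡ-≡ X (9 + 3 * j) 4
      (+-cancelˡ-≡ ((5 + 2 * j + 0) * (5 + 2 * j + 0)) (4 * X) (4 * (9 + 3 * j)) (trans (sym eq) (identity j)))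
    where
    identity : ∀ j → (7 + 2 * j) * (8 + 2 * j) + (5 + 2 * j + 0) ≡ (5 + 2 * j + 0) * (5 + 2 * j + 0) + 4 * (9 + 3 * j)
    identity = solve-∀
  cases (suc zero) _ eq = ⊥-elim (even≢odd X (6 + 2 * j) (trans 2X≡ (odd j)))
    where
    identity : ∀ j → (7 + 2 * j) * (8 + 2 * j) + (5 + 2 * j + 1) ≡ (5 + 2 * j + 1) * (5 + 2 * j + 1) + 2 * (13 + 4 * j)
    identity = solve-∀
    4≡2*2 : ∀ X → 4 * X ≡ 2 * (2 * X)
    4≡2*2 = solve-∀
    odd : ∀ j → 13 + 4 * j ≡ suc (2 * (6 + 2 * j))
    odd = solve-∀
    hh = (5 + 2 * j + 1) * (5 + 2 * j + 1)
    2X≡ : 2 * X ≡ 13 + 4 * j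
    2X≡ = *-cancelˡ-≡ (2 * X) (13 + 4 * j) 2 (+-cancelˡ-≡ hh (2 * (2 * X)) (2 * (13 + 4 * j))
            (trans (cong (hh +_) (sym (4≡2*2 X))) (trans (sym eq) (identity j))))
  cases (suc (suc e)) h≤X eq = ⊥-elim (m+1+n≰m (n * (1 + n) + h) (begin
    n * (1 + n) + h + suc (13 + 4 * j + 17 * e + 4 * j * e + e * e)  ≡⟨ identity j e ⟩
    h * h + 4 * h                                                   ≤⟨ +-monoʳ-≤ (h * h) (*-monoʳ-≤ 4 h≤X) ⟩
    h * h + 4 * X                                                   ≡⟨ eq ⟨
    n * (1 + n) + h                                                 ∎))
    where
    open ≤-Reasoning
    h = 5 + 2 * j + suc (suc e)
    identity : ∀ j e → let h = 5 + 2 * j + suc (suc e) in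
               (7 + 2 * j) * (1 + (7 + 2 * j)) + h + suc (13 + 4 * j + 17 * e + 4 * j * e + e * e) ≡ h * h + 4 * h
    identity = solve-∀

odd-case-arithmetic : ∀ j {h E′} → 5 + 2 * j ≤ h →
                      (7 + 2 * j) * (8 + 2 * j) + suc h ≡ suc h * suc h + 2 * (E′ + suc (h + h)) → E′ ≡ 2
odd-case-arithmetic j {E′ = E′} 5+2j≤h eq with e , refl ← m≤n⇒∃[o]m+o≡n 5+2j≤h = cases e eq
  where
  n = 7 + 2 * j
  cases : ∀ e → let h = 5 + 2 * j + e in n * (1 + n) + suc h ≡ suc h * suc h + 2 * (E′ + suc (h + h)) → E′ ≡ 2
  cases zero eq = +-cancelʳ-≡ top E′ 2 (*-cancelˡ-≡ (E′ + top) (2 + top) 2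
                    (+-cancelˡ-≡ (suc h * suc h) (2 * (E′ + top)) (2 * (2 + top)) (trans (sym eq) (identity j))))
    where
    h = 5 + 2 * j + 0
    top = suc (h + h)
    identity : ∀ j → let h = 5 + 2 * j + 0 in
               (7 + 2 * j) * (1 + (7 + 2 * j)) + suc h ≡ suc h * suc h + 2 * (2 + suc (h + h))
    identity = solve-∀
  cases (suc e) eq = ⊥-elim (m+1+n≰m (n * (1 + n) + suc h) (begin
    n * (1 + n) + suc h + suc (11 + 4 * j + 17 * e + 4 * j * e + e * e)
      ≡⟨ identity j e ⟩
    suc h * suc h + 2 * suc (h + h)
      ≤⟨ +-monoʳ-≤ (suc h * suc h) (*-monoʳ-≤ 2 (m≤n+m (suc (h + h)) E′)) ⟩
    suc h * suc h + 2 * (E′ + suc (h + h))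
      ≡⟨ eq ⟨
    n * (1 + n) + suc h
      ∎))
    where
    open ≤-Reasoning
    h = 5 + 2 * j + suc e
    identity : ∀ j e → let h = 5 + 2 * j + suc e in
               (7 + 2 * j) * (1 + (7 + 2 * j)) + suc h + suc (11 + 4 * j + 17 * e + 4 * j * e + e * e)
               ≡ suc h * suc h + 2 * suc (h + h)
    identity = solve-∀

-- n = 2k − 1 = 7 + 2j.
module Ubar (j : ℕ) {ps : List ℕ} (ū : InUbar (T (7 + 2 * j)) ps) where

  open DistinctPartition (proj₁ (proj₁ ū))

  private
    unref : Unrefinable ps
    unref = proj₁ (proj₂ (proj₂ (proj₁ ū)))

    2*sum≡ : 2 * sum ps ≡ (7 + 2 * j) * (8 + 2 * j)
    2*sum≡ = trans (cong (2 *_) (proj₁ (proj₂ (proj₁ ū)))) (2*T[7+2j] j)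

    10+4j≤L : (5 + 2 * j) + (5 + 2 * j) ≤ L
    10+4j≤L = subst (_≤ L) (identity j) (maximal⇒8+2m≤largest (1 + 2 * j) (proj₁ ū))
      where
      identity : ∀ j → 8 + 2 * (1 + 2 * j) ≡ (5 + 2 * j) + (5 + 2 * j)
      identity = solve-∀

  -- E is a sum of distinct odd numbers, among them 2h + 1 from the pair of L; the arithmetic
  -- leaves 2 for the others.
  odd-largest-impossible : ∀ {h} → L ≡ suc (h + h) → numMissing ps ≡ h → ⊥
  odd-largest-impossible {h} L≡ #M≡ = ∑-odd≢2 h (λ d → χ≤1 (up d)) E′≡2
    where
    1+L≡ : suc L ≡ suc h + 0 + suc h
    1+L≡ = cong suc (trans L≡ (sym (trans (cong (_+ suc h) (+-identityʳ h)) (+-suc h h))))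

    open Complementary unref {suc h} {0} z≤n 1+L≡ (cong suc #M≡)

    E′ : ℕ
    E′ = ∑[ d < h ] χ (up d) * suc (d + d)

    top-is-part : χ (up h) ≡ 1
    top-is-part = 𝟙-yes (up h ∈? ps) (subst (_∈ ps) (sym up≡L) largest∈)
      where
      up≡L : up h ≡ L
      up≡L = trans (cong (_+ up h) (sym (n∸n≡0 h))) (lo+up≡L ≤-refl)

    E≡ : E ≡ E′ + suc (h + h)
    E≡ = cong₂ _+_ (∑-cong h (λ d _ → cong (χ (up d) *_) (+-identityʳ (suc (d + d)))))
                   (trans (cong (_* (suc (h + h) + 0)) top-is-part) (trans (*-identityˡ _) (+-identityʳ _)))

    E′≡2 : E′ ≡ 2
    E′≡2 = odd-case-arithmetic j (k+k≤1+h+h⇒k≤h (subst (_ ≤_) L≡ 10+4j≤L)) (begin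
      (7 + 2 * j) * (8 + 2 * j) + suc h       ≡⟨ cong (_+ suc h) 2*sum≡ ⟨
      2 * sum ps + suc h                      ≡⟨ sum-formula ⟩
      suc h * suc h + 2 * E                   ≡⟨ cong (λ e → suc h * suc h + 2 * e) E≡ ⟩
      suc h * suc h + 2 * (E′ + suc (h + h))  ∎)
      where open ≡-Reasoning

  module EvenLargest {h} (L≡h+h : L ≡ h + h) (#M≡h : numMissing ps ≡ h) where

    open Complementary unref {h} {1} ≤-refl (trans (cong suc L≡h+h) (cong (_+ h) (+-comm 1 h))) (cong suc #M≡h)
    open Gap (middle∉ refl)

    X : ℕ
    X = sum (map (_∸ h) ps)

    L∸h≡h : L ∸ h ≡ h
    L∸h≡h = trans (cong (_∸ h) L≡h+h) (m+n∸m≡n h h)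

    5+2j≤h : 5 + 2 * j ≤ h
    5+2j≤h = k+k≤1+h+h⇒k≤h (≤-trans (subst (_ ≤_) L≡h+h 10+4j≤L) (n≤1+n (h + h)))

    0<q : 0 < q
    0<q = c<L⇒0<q (subst (h <_) (sym L≡h+h) (m<m+n h (≤-trans (s≤s z≤n) 5+2j≤h)))

    h+column≡X : h + hookColSum ps q (suc p) ≡ X
    h+column≡X = trans (cong (_+ hookColSum ps q (suc p)) (sym L∸h≡h)) (hookColSum-at-gap 0<q)

    E≡2X : E ≡ 2 * X
    E≡2X = trans (∑-cong h (λ d _ → double (χ (up d)) d))
                 (trans (sym (*-distribˡ-∑ 2 (λ d → χ (up d) * (1 + d)) h)) (cong (2 *_) (sym excess-formula)))
      where
      double : ∀ x d → x * (suc (d + d) + 1) ≡ 2 * (x * (1 + d))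
      double = solve-∀

    h≡×X≡ : h ≡ 5 + 2 * j × X ≡ 9 + 3 * j
    h≡×X≡ = even-case-arithmetic j 5+2j≤h (subst (h ≤_) h+column≡X (m≤m+n h _)) (begin
      (7 + 2 * j) * (8 + 2 * j) + h   ≡⟨ cong (_+ h) 2*sum≡ ⟨
      2 * sum ps + h                  ≡⟨ sum-formula ⟩
      h * h + 2 * E                   ≡⟨ cong (λ e → h * h + 2 * e) E≡2X ⟩
      h * h + 2 * (2 * X)             ≡⟨ cong (h * h +_) (*-assoc 2 2 X) ⟨
      h * h + 4 * X                   ∎)
      where open ≡-Reasoning

    p≡q : p ≡ q
    p≡q = +-cancelʳ-≡ (h ∸ q) p q (begin
      p + (h ∸ q)   ≡⟨ cong (λ n → p + (n ∸ q)) length≡c ⟨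
      p + (t ∸ q)   ≡⟨ p+[t∸q]≡c ⟩
      h             ≡⟨ m+[n∸m]≡n (subst (q ≤_) length≡c q≤t) ⟨
      q + (h ∸ q)   ∎)
      where open ≡-Reasoning

    hook-in-gap-column : ∀ {z} → suc z ≤ rowLen ps 1 → hook ps 1 (suc z) ≡ 5 + 2 * j → z ≡ q
    hook-in-gap-column {z} z<R hook≡ = trans (hook-injective 1 z<R (rowLen-above 0<q) (begin
      hook ps 1 (suc z)   ≡⟨ hook≡ ⟩
      5 + 2 * j           ≡⟨ proj₁ h≡×X≡ ⟨
      h                   ≡⟨ L∸h≡h ⟨
      L ∸ h               ≡⟨ cong (_∸ h) rowPart-1≡largest ⟨
      nth rs 0 ∸ h        ≡⟨ hook-at-gap 0<q ⟨
      hook ps 1 (suc p)   ∎)) p≡q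
      where open ≡-Reasoning

    hookColSum-gap-column : hookColSum ps q (suc q) ≡ 4 + j
    hookColSum-gap-column = +-cancelˡ-≡ h (hookColSum ps q (suc q)) (4 + j) (begin
      h + hookColSum ps q (suc q)     ≡⟨ cong (λ y → h + hookColSum ps q (suc y)) p≡q ⟨
      h + hookColSum ps q (suc p)     ≡⟨ h+column≡X ⟩
      X                               ≡⟨ proj₂ h≡×X≡ ⟩
      9 + 3 * j                       ≡⟨ split j ⟩
      (5 + 2 * j) + (4 + j)           ≡⟨ cong (_+ (4 + j)) (proj₁ h≡×X≡) ⟨
      h + (4 + j)                     ∎)
      where
      open ≡-Reasoning
      split : ∀ j → 9 + 3 * j ≡ (5 + 2 * j) + (4 + j)
      split = solve-∀

proposition3p10 : (k : ℕ) → 4 ≤ k → (ps : List ℕ) → InUbar (T (2 * k ∸ 1)) ps →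
    (z : ℕ) → 1 ≤ z → suc z ≤ rowLen ps 1 → hook ps 1 (suc z) ≡ (2 * k ∸ 1) ∸ 2 →
    hookColSum ps z (suc z) ≡ k
proposition3p10 k 4≤k ps ū z _ z<R hook≡ with j , refl ← m≤n⇒∃[o]m+o≡n 4≤k =
  by-parity (half-parity (largest ps))
  where
  n≡7+2j : 2 * (4 + j) ∸ 1 ≡ 7 + 2 * j
  n≡7+2j = cong (_∸ 1) (double j)
    where
    double : ∀ j → 2 * (4 + j) ≡ 8 + 2 * j
    double = solve-∀

  open Ubar j (subst (λ n → InUbar (T n) ps) n≡7+2j ū)

  by-parity : let L = largest ps in L ≡ L / 2 + L / 2 ⊎ L ≡ suc (L / 2 + L / 2) →
              hookColSum ps z (suc z) ≡ 4 + j
  by-parity (inj₁ L≡h+h)  =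
    subst (λ y → hookColSum ps y (suc y) ≡ 4 + j) (sym (hook-in-gap-column z<R hook≡′)) hookColSum-gap-column
    where
    open EvenLargest L≡h+h (proj₂ ū)
    hook≡′ = trans hook≡ (cong (_∸ 2) n≡7+2j)
  by-parity (inj₂ L≡1+2h) = ⊥-elim (odd-largest-impossible L≡1+2h (proj₂ ū))
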